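{- Let $p$ be an odd prime and let $\mathcal{P}$ be an integral point set over $\mathbb{E}_p^2$. Then all non-degenerate triangles of $\mathcal{P}$ have the same characteristic; i.e. if $\{v_1,v_2,v_3\}$ and $\{v_1',v_2',v_3'\}$ are two triples of points of $\mathcal{P}$ with side lengths $a,b,c$ and $a',b',c'$ respectively and $V^2\neq 0$, $V'^2\neq 0$, then either both $V^2$ and $V'^2$ are quadratic residues in $\mathbb{Z}_p$ or neither is.
   Context: Let $p$ be an odd prime, $\mathbb{Z}_p=\mathbb{Z}/p\mathbb{Z}$, $\alpha(p)$ the smallest quadratic non-residue modulo $p$, and $K=\mathbb{Z}_p(\sqrt{\alpha(p)})$ the quadratic extension field. Following the paper, $\mathbb{E}_p^2$ is modelled by $K^2$ with coordinates of the form $x$ or $y\sqrt{\alpha(p)}$ with $x,y\in\mathbb{Z}_p$ arising, and an integral point set over $\mathbb{E}_p^2$ is a set of points of $K^2$ such that for any two distinct points $(x_1,y_1),(x_2,y_2)$ there is $d\in\mathbb{Z}_p\setminus\{0\}$ (the side length or distance) with $(x_1-x_2)^2+(y_1-y_2)^2=d^2$. For three points with side lengths $a,b,c\in\mathbb{Z}_p$, put $V^2=(a+b+c)(a+b-c)(a-b+c)(-a+b+c)\in\mathbb{Z}_p$ (it depends only on $a^2,b^2,c^2$); the triangle is non-degenerate if $V^2\neq 0$, and then its characteristic is $1$ if $V^2$ is a quadratic residue in $\mathbb{Z}_p$ and $\alpha(p)$ otherwise. -}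

module Defs where

open import Data.Nat using (ℕ; _≤_; _<_)
open import Data.Integer using (ℤ; +_; _+_; _-_; _*_; -_)
open import Data.Integer.Divisibility using (_∣_)
open import Data.Product using (_×_; _,_; ∃)
open import Relation.Nullary using (¬_)

-- Elements of ℤ_p are represented by integers; equality in ℤ_p is
-- congruence modulo p.
Congr : ℕ → ℤ → ℤ → Set
Congr p a b = (+ p) ∣ (a - b)

QR : ℕ → ℤ → Set
QR p x = (¬ Congr p x (+ 0)) × ∃ λ y → Congr p (y * y) x

QNR : ℕ → ℤ → Set
QNR p x = (¬ Congr p x (+ 0)) × (¬ ∃ λ y → Congr p (y * y) x)

IsSmallestNonResidue : ℕ → ℕ → Set
IsSmallestNonResidue p α =
  (1 ≤ α) × QNR p (+ α) × (∀ (m : ℕ) → 1 ≤ m → m < α → ¬ QNR p (+ m))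

-- The field K = ℤ_p(√α): x + y√α is represented by the pair (x , y).
K : Set
K = ℤ × ℤ

KCongr : ℕ → K → K → Set
KCongr p (x₁ , y₁) (x₂ , y₂) = Congr p x₁ x₂ × Congr p y₁ y₂

Ksub : K → K → K
Ksub (x₁ , y₁) (x₂ , y₂) = (x₁ - x₂ , y₁ - y₂)

Kadd : K → K → K
Kadd (x₁ , y₁) (x₂ , y₂) = (x₁ + x₂ , y₁ + y₂)

-- multiplication in K, depending on α (√α * √α = α)
Kmul : ℕ → K → K → K
Kmul α (x₁ , y₁) (x₂ , y₂) = (x₁ * x₂ + (+ α) * (y₁ * y₂) , x₁ * y₂ + y₁ * x₂)

-- Points of 𝔼_p² modelled by K².
Point : Set
Point = K × K

PointEq : ℕ → Point → Point → Set
PointEq p (u₁ , u₂) (v₁ , v₂) = KCongr p u₁ v₁ × KCongr p u₂ v₂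

sqDist : ℕ → Point → Point → K
sqDist α (u₁ , u₂) (v₁ , v₂) =
  Kadd (Kmul α (Ksub u₁ v₁) (Ksub u₁ v₁)) (Kmul α (Ksub u₂ v₂) (Ksub u₂ v₂))

IsDistance : ℕ → ℕ → Point → Point → ℤ → Set
IsDistance p α u v d =
  (¬ Congr p d (+ 0)) × KCongr p (sqDist α u v) (d * d , + 0)

IntegralPointSet : ℕ → ℕ → (Point → Set) → Set
IntegralPointSet p α 𝒫 =
  ∀ u v → 𝒫 u → 𝒫 v → ¬ PointEq p u v → ∃ λ d → IsDistance p α u v d

V² : ℤ → ℤ → ℤ → ℤ
V² a b c = (a + b + c) * (a + b - c) * (a - b + c) * ((- a) + b + c)

module Submission where

-- For a triangle v₁v₂v₃ let Δ = 2·det(v₂ − v₁, v₃ − v₁) ∈ K, four times its signed area.  Two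
-- polynomial identities in ℤ[√α], proved by the ring solver, drive the argument:
--   Heron          V²(a, b, c) = Δ²  when a², b², c² are the squared side lengths (quadrances);
--   Binet–Cauchy   Δ·Δ′ is a polynomial in the quadrances between the vertices of two triangles.
-- Read modulo p: in an integral point set every quadrance lies in the prime field ℤ_p ⊆ K, hence
-- so do Δ², Δ′² and ΔΔ′.  Writing Δ = r + s√α, Δ² ∈ ℤ_p means p ∣ 2rs, so either s ≡ 0 and
-- V² ≡ r² is a residue, or r ≡ 0 and V² ≡ αs² is a non-residue (α is one): V² is a residue iff
-- Δ ∈ ℤ_p.  Finally ΔΔ′ ∈ ℤ_p with Δ, Δ′ ≢ 0 gives Δ ∈ ℤ_p ⇔ Δ′ ∈ ℤ_p.

open import Defs
open import Data.Nat using (ℕ; _%_)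
open import Data.Nat.Primality using (Prime)
open import Data.Integer using (ℤ; +_)
open import Relation.Binary.PropositionalEquality
  using (_≡_; refl; sym; trans; cong; cong₂; subst; isEquivalence; module ≡-Reasoning)
open import Relation.Nullary using (¬_)
open import Function.Bundles using (_⇔_; mk⇔)
open import Data.Product using (_×_; _,_; proj₁; proj₂; ∃)
open import Function.Base using (_∘_)
open import Algebra.Bundles using (CommutativeRing)
open import Algebra.Bundles.Raw using (RawRing)

module QuadraticIntegers (α : ℕ) where
  open import Data.Integer using (_+_; _*_; -_)
  import Data.Integer.Properties as ℤ
  open import Data.Integer.Tactic.RingSolver using (solve-∀)
  open import Algebra.Structures {A = K} _≡_ using (IsCommutativeRing)

  Kneg : K → K
  Kneg (x , y) = (- x , - y)

  K0 K1 : K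
  K0 = (+ 0 , + 0)
  K1 = (+ 1 , + 0)

  private
    _*ᴷ_ : K → K → K
    _*ᴷ_ = Kmul α

    A : ℤ
    A = + α

    +-assoc : ∀ x y z → Kadd (Kadd x y) z ≡ Kadd x (Kadd y z)
    +-assoc (a , b) (c , d) (e , f) = cong₂ _,_ (ℤ.+-assoc a c e) (ℤ.+-assoc b d f)

    +-comm : ∀ x y → Kadd x y ≡ Kadd y x
    +-comm (a , b) (c , d) = cong₂ _,_ (ℤ.+-comm a c) (ℤ.+-comm b d)

    +-identityˡ : ∀ x → Kadd K0 x ≡ x
    +-identityˡ (a , b) = cong₂ _,_ (ℤ.+-identityˡ a) (ℤ.+-identityˡ b)

    +-identityʳ : ∀ x → Kadd x K0 ≡ x
    +-identityʳ (a , b) = cong₂ _,_ (ℤ.+-identityʳ a) (ℤ.+-identityʳ b)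

    +-inverseˡ : ∀ x → Kadd (Kneg x) x ≡ K0
    +-inverseˡ (a , b) = cong₂ _,_ (ℤ.+-inverseˡ a) (ℤ.+-inverseˡ b)

    +-inverseʳ : ∀ x → Kadd x (Kneg x) ≡ K0
    +-inverseʳ (a , b) = cong₂ _,_ (ℤ.+-inverseʳ a) (ℤ.+-inverseʳ b)

    *-comm : ∀ x y → x *ᴷ y ≡ y *ᴷ x
    *-comm (a , b) (c , d) = cong₂ _,_ (re a b c d A) (im a b c d)
      where
      re : ∀ a b c d A → a * c + A * (b * d) ≡ c * a + A * (d * b)
      re = solve-∀
      im : ∀ a b c d → a * d + b * c ≡ c * b + d * a
      im = solve-∀

    *-assoc : ∀ x y z → (x *ᴷ y) *ᴷ z ≡ x *ᴷ (y *ᴷ z)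
    *-assoc (a , b) (c , d) (e , f) = cong₂ _,_ (re a b c d e f A) (im a b c d e f A)
      where
      re : ∀ a b c d e f A → (a * c + A * (b * d)) * e + A * ((a * d + b * c) * f)
                           ≡ a * (c * e + A * (d * f)) + A * (b * (c * f + d * e))
      re = solve-∀
      im : ∀ a b c d e f A → (a * c + A * (b * d)) * f + (a * d + b * c) * e
                           ≡ a * (c * f + d * e) + b * (c * e + A * (d * f))
      im = solve-∀

    *-identityˡ : ∀ x → K1 *ᴷ x ≡ x
    *-identityˡ (a , b) = cong₂ _,_ (re a b A) (im a b)
      where
      re : ∀ a b A → + 1 * a + A * (+ 0 * b) ≡ a
      re = solve-∀
      im : ∀ a b → + 1 * b + + 0 * a ≡ b
      im = solve-∀

    *-identityʳ : ∀ x → x *ᴷ K1 ≡ x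
    *-identityʳ x = trans (*-comm x K1) (*-identityˡ x)

    distribˡ : ∀ x y z → x *ᴷ Kadd y z ≡ Kadd (x *ᴷ y) (x *ᴷ z)
    distribˡ (a , b) (c , d) (e , f) = cong₂ _,_ (re a b c d e f A) (im a b c d e f)
      where
      re : ∀ a b c d e f A → a * (c + e) + A * (b * (d + f))
                           ≡ (a * c + A * (b * d)) + (a * e + A * (b * f))
      re = solve-∀
      im : ∀ a b c d e f → a * (d + f) + b * (c + e) ≡ (a * d + b * c) + (a * f + b * e)
      im = solve-∀

    distribʳ : ∀ x y z → Kadd y z *ᴷ x ≡ Kadd (y *ᴷ x) (z *ᴷ x)
    distribʳ x y z = begin
      Kadd y z *ᴷ x           ≡⟨ *-comm (Kadd y z) x ⟩
      x *ᴷ Kadd y z           ≡⟨ distribˡ x y z ⟩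
      Kadd (x *ᴷ y) (x *ᴷ z)  ≡⟨ cong₂ Kadd (*-comm x y) (*-comm x z) ⟩
      Kadd (y *ᴷ x) (z *ᴷ x)  ∎
      where open ≡-Reasoning

  isCommutativeRing : IsCommutativeRing Kadd (Kmul α) Kneg K0 K1
  isCommutativeRing = record
    { isRing = record
      { +-isAbelianGroup = record
        { isGroup = record
          { isMonoid = record
            { isSemigroup = record
              { isMagma = record { isEquivalence = isEquivalence ; ∙-cong = cong₂ Kadd }
              ; assoc = +-assoc }
            ; identity = +-identityˡ , +-identityʳ }
          ; inverse = +-inverseˡ , +-inverseʳ
          ; ⁻¹-cong = cong Kneg }
        ; comm = +-comm }
      ; *-cong = cong₂ (Kmul α)
      ; *-assoc = *-assoc
      ; *-identity = *-identityˡ , *-identityʳ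
      ; distrib = distribˡ , distribʳ }
    ; *-comm = *-comm }

  ℤ[√α] : CommutativeRing _ _
  ℤ[√α] = record { isCommutativeRing = isCommutativeRing }

module PlaneFormulas {c ℓ} (R : RawRing c ℓ) where
  open RawRing R

  Pt : Set c
  Pt = Carrier × Carrier

  infixl 6 _-_
  _-_ : Carrier → Carrier → Carrier
  x - y = x + - y

  two : Carrier
  two = 1# + 1#

  private
    sq : Carrier → Carrier
    sq x = x * x

  quadrance : Pt → Pt → Carrier
  quadrance (u₁ , u₂) (v₁ , v₂) = sq (u₁ - v₁) + sq (u₂ - v₂)

  Δ : Pt → Pt → Pt → Carrier
  Δ (u₁ , u₂) (v₁ , v₂) (w₁ , w₂) = two * ((v₁ - u₁) * (w₂ - u₂) - (v₂ - u₂) * (w₁ - u₁))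

  heronForm : Carrier → Carrier → Carrier → Carrier
  heronForm A B C = two * two * B * C - sq (B + C - A)

  -- polarisation: polar u v w z = 2⟨u − v, w − z⟩, written with quadrances only
  polar : Pt → Pt → Pt → Pt → Carrier
  polar u v w z = quadrance u z + quadrance v w - quadrance u w - quadrance v z

  heronProduct : Carrier → Carrier → Carrier → Carrier
  heronProduct a b c = (a + b + c) * (a + b - c) * (a - b + c) * (- a + b + c)

-- Here
-- quadrance coincides definitionally with sqDist α of Defs.  The identities are checked by the
-- ring solver with integer coefficients, which acts on ℤ[√α] through the embedding ι.
module PlaneIdentities (α : ℕ) where
  open QuadraticIntegers α
  open CommutativeRing ℤ[√α] using (rawRing; _+_; _*_; -_)
  open PlaneFormulas rawRing public
  import Data.Integer as ℤ
  import Data.Integer.Properties as ℤ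
  open import Data.Integer.Tactic.RingSolver using (solve-∀)
  open import Data.Maybe using (map)
  open import Relation.Nullary.Decidable using (dec⇒maybe)
  open import Algebra.Solver.Ring.AlmostCommutativeRing
    using (_-Raw-AlmostCommutative⟶_; fromCommutativeRing)

  -- ℤ ⊆ ℤ[√α]; ι is additive and preserves 0, 1 and negation by computation
  ι : ℤ → K
  ι x = (x , ℤ.+ 0)

  ι-* : ∀ x y → ι (x ℤ.* y) ≡ ι x * ι y
  ι-* x y = cong₂ _,_ (re x y (ℤ.+ α)) (im x y)
    where
    re : ∀ x y A → x ℤ.* y ≡ x ℤ.* y ℤ.+ A ℤ.* (ℤ.+ 0 ℤ.* ℤ.+ 0)
    re = solve-∀
    im : ∀ x y → ℤ.+ 0 ≡ x ℤ.* ℤ.+ 0 ℤ.+ ℤ.+ 0 ℤ.* y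
    im = solve-∀

  ι-hom : CommutativeRing.rawRing ℤ.+-*-commutativeRing -Raw-AlmostCommutative⟶ fromCommutativeRing ℤ[√α]
  ι-hom = record
    { ⟦_⟧ = ι ; +-homo = λ _ _ → refl ; *-homo = ι-* ; -‿homo = λ _ → refl
    ; 0-homo = refl ; 1-homo = refl }

  open import Algebra.Solver.Ring _ (fromCommutativeRing ℤ[√α]) ι-hom
    (λ x y → map (cong ι) (dec⇒maybe (x ℤ.≟ y)))

  private
    -- polynomials in n variables form a raw ring, so the formulas of PlaneFormulas can be
    -- written as solver syntax; their meaning is the same formula in ℤ[√α]
    Syntax : ℕ → RawRing _ _
    Syntax n = record
      { Carrier = Polynomial n ; _≈_ = _≡_ ; _+_ = _:+_ ; _*_ = _:*_ ; -_ = :-_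
      ; 0# = con (ℤ.+ 0) ; 1# = con (ℤ.+ 1) }

    module Syn (n : ℕ) = PlaneFormulas (Syntax n)
    module S₆ = Syn 6
    module S₁₂ = Syn 12
    module S₃ = Syn 3

  heron : ∀ u v w → heronForm (quadrance v w) (quadrance u w) (quadrance u v) ≡ Δ u v w * Δ u v w
  heron (u₁ , u₂) (v₁ , v₂) (w₁ , w₂) =
    solve 6 (λ u₁ u₂ v₁ v₂ w₁ w₂ →
      let u = (u₁ , u₂); v = (v₁ , v₂); w = (w₁ , w₂)
      in S₆.heronForm (S₆.quadrance v w) (S₆.quadrance u w) (S₆.quadrance u v) := S₆.Δ u v w :* S₆.Δ u v w)
      refl u₁ u₂ v₁ v₂ w₁ w₂

  -- Binet–Cauchy: as polar = 2⟨_,_⟩, the left side is 4·det of the matrix (⟨vᵢ − v₁, wⱼ − w₁⟩)ᵢⱼ,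
  -- i, j ∈ {2, 3}, which equals 4·det(v₂ − v₁, v₃ − v₁)·det(w₂ − w₁, w₃ − w₁)
  binetCauchy : ∀ v₁ v₂ v₃ w₁ w₂ w₃ →
    polar v₂ v₁ w₂ w₁ * polar v₃ v₁ w₃ w₁ - polar v₂ v₁ w₃ w₁ * polar v₃ v₁ w₂ w₁
      ≡ Δ v₁ v₂ v₃ * Δ w₁ w₂ w₃
  binetCauchy (a₁ , a₂) (b₁ , b₂) (c₁ , c₂) (e₁ , e₂) (f₁ , f₂) (g₁ , g₂) =
    solve 12 (λ a₁ a₂ b₁ b₂ c₁ c₂ e₁ e₂ f₁ f₂ g₁ g₂ →
      let a = (a₁ , a₂); b = (b₁ , b₂); c = (c₁ , c₂); e = (e₁ , e₂); f = (f₁ , f₂); g = (g₁ , g₂)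
      in S₁₂.polar b a f e :* S₁₂.polar c a g e S₁₂.- S₁₂.polar b a g e :* S₁₂.polar c a f e
         := S₁₂.Δ a b c :* S₁₂.Δ e f g)
      refl a₁ a₂ b₁ b₂ c₁ c₂ e₁ e₂ f₁ f₂ g₁ g₂

  heronProduct-squares : ∀ x y z → heronProduct x y z ≡ heronForm (x * x) (y * y) (z * z)
  heronProduct-squares = solve 3 (λ x y z →
    S₃.heronProduct x y z := S₃.heronForm (x :* x) (y :* y) (z :* z)) refl

  ι-heronProduct : ∀ a b c → ι (V² a b c) ≡ heronProduct (ι a) (ι b) (ι c)
  ι-heronProduct a b c = begin
    ι (X ℤ.* Y ℤ.* Z ℤ.* W)      ≡⟨ ι-* (X ℤ.* Y ℤ.* Z) W ⟩
    ι (X ℤ.* Y ℤ.* Z) * ι W      ≡⟨ cong (_* ι W) (ι-* (X ℤ.* Y) Z) ⟩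
    ι (X ℤ.* Y) * ι Z * ι W      ≡⟨ cong (λ t → t * ι Z * ι W) (ι-* X Y) ⟩
    ι X * ι Y * ι Z * ι W        ∎
    where
    open ≡-Reasoning
    X = a ℤ.+ b ℤ.+ c
    Y = a ℤ.+ b ℤ.- c
    Z = a ℤ.- b ℤ.+ c
    W = ℤ.- a ℤ.+ b ℤ.+ c

module Congruences (p α : ℕ) where
  open import Data.Integer using (_+_; _-_; _*_; -_)
  import Data.Integer.Properties as ℤ
  open import Data.Integer.Tactic.RingSolver using (solve-∀)
  open import Data.Integer.Divisibility.Signed
    using (_∣_; divides; ∣ᵤ⇒∣; ∣⇒∣ᵤ; ∣m∣n⇒∣m+n; ∣n⇒∣m*n; ∣m⇒∣m*n; ∣m⇒∣-m)
  open import Relation.Binary.Bundles using (Setoid)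
  open QuadraticIntegers α using (Kneg)

  -- a ≈ b is a ≡ b (mod p); unlike Congr p a b it determines a and b, so they can be inferred
  infix 4 _≈_ _≈ᴷ_
  record _≈_ (a b : ℤ) : Set where
    constructor mod
    field p∣a-b : + p ∣ a - b
  open _≈_ public

  fromCongr : ∀ {a b} → Congr p a b → a ≈ b
  fromCongr c = mod (∣ᵤ⇒∣ c)

  toCongr : ∀ {a b} → a ≈ b → Congr p a b
  toCongr (mod d) = ∣⇒∣ᵤ d

  _≈ᴷ_ : K → K → Set
  (x₁ , y₁) ≈ᴷ (x₂ , y₂) = x₁ ≈ x₂ × y₁ ≈ y₂

  fromKCongr : ∀ {x y} → KCongr p x y → x ≈ᴷ y
  fromKCongr (c , d) = fromCongr c , fromCongr d

  ∣-lin₁ : ∀ k₁ {e₁ t} → + p ∣ e₁ → t ≡ k₁ * e₁ → + p ∣ t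
  ∣-lin₁ k₁ p∣e₁ refl = ∣n⇒∣m*n k₁ p∣e₁

  ∣-lin₂ : ∀ k₁ k₂ {e₁ e₂ t} → + p ∣ e₁ → + p ∣ e₂ → t ≡ k₁ * e₁ + k₂ * e₂ → + p ∣ t
  ∣-lin₂ k₁ k₂ p∣e₁ p∣e₂ refl = ∣m∣n⇒∣m+n (∣n⇒∣m*n k₁ p∣e₁) (∣n⇒∣m*n k₂ p∣e₂)

  ∣-lin₃ : ∀ k₁ k₂ k₃ {e₁ e₂ e₃ t} → + p ∣ e₁ → + p ∣ e₂ → + p ∣ e₃ →
           t ≡ k₁ * e₁ + k₂ * e₂ + k₃ * e₃ → + p ∣ t
  ∣-lin₃ k₁ k₂ k₃ p∣e₁ p∣e₂ p∣e₃ refl =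
    ∣m∣n⇒∣m+n (∣-lin₂ k₁ k₂ p∣e₁ p∣e₂ refl) (∣n⇒∣m*n k₃ p∣e₃)

  ≈0⇒∣ : ∀ {a} → a ≈ + 0 → + p ∣ a
  ≈0⇒∣ {a} (mod p∣a-0) = subst (+ p ∣_) (ℤ.+-identityʳ a) p∣a-0

  ∣⇒≈0 : ∀ {a} → + p ∣ a → a ≈ + 0
  ∣⇒≈0 {a} p∣a = mod (subst (+ p ∣_) (sym (ℤ.+-identityʳ a)) p∣a)

  ≈-refl : ∀ {a} → a ≈ a
  ≈-refl {a} = mod (subst (+ p ∣_) (sym (ℤ.+-inverseʳ a)) (divides (+ 0) refl))

  ≈-sym : ∀ {a b} → a ≈ b → b ≈ a
  ≈-sym {a} {b} (mod d) = mod (∣-lin₁ (- + 1) d (eq a b))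
    where eq : ∀ a b → b - a ≡ (- + 1) * (a - b)
          eq = solve-∀

  ≈-trans : ∀ {a b c} → a ≈ b → b ≈ c → a ≈ c
  ≈-trans {a} {b} {c} (mod d) (mod e) = mod (∣-lin₂ (+ 1) (+ 1) d e (eq a b c))
    where eq : ∀ a b c → a - c ≡ + 1 * (a - b) + + 1 * (b - c)
          eq = solve-∀

  ≈-+ : ∀ {a b c d} → a ≈ b → c ≈ d → a + c ≈ b + d
  ≈-+ {a} {b} {c} {d} (mod e) (mod f) = mod (∣-lin₂ (+ 1) (+ 1) e f (eq a b c d))
    where eq : ∀ a b c d → (a + c) - (b + d) ≡ + 1 * (a - b) + + 1 * (c - d)
          eq = solve-∀

  ≈-* : ∀ {a b c d} → a ≈ b → c ≈ d → a * c ≈ b * d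
  ≈-* {a} {b} {c} {d} (mod e) (mod f) = mod (∣-lin₂ c b e f (eq a b c d))
    where eq : ∀ a b c d → a * c - b * d ≡ c * (a - b) + b * (c - d)
          eq = solve-∀

  ≈-neg : ∀ {a b} → a ≈ b → - a ≈ - b
  ≈-neg {a} {b} (mod e) = mod (∣-lin₁ (- + 1) e (eq a b))
    where eq : ∀ a b → - a - - b ≡ (- + 1) * (a - b)
          eq = solve-∀

  ≈ᴷ-setoid : Setoid _ _
  ≈ᴷ-setoid = record
    { Carrier = K
    ; _≈_ = _≈ᴷ_
    ; isEquivalence = record
      { refl = ≈-refl , ≈-refl
      ; sym = λ (x , y) → ≈-sym x , ≈-sym y
      ; trans = λ (x , y) (x′ , y′) → ≈-trans x x′ , ≈-trans y y′ } }

  ≈ᴷ-+ : ∀ {x x′ y y′} → x ≈ᴷ x′ → y ≈ᴷ y′ → Kadd x y ≈ᴷ Kadd x′ y′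
  ≈ᴷ-+ (a , b) (c , d) = ≈-+ a c , ≈-+ b d

  ≈ᴷ-neg : ∀ {x x′} → x ≈ᴷ x′ → Kneg x ≈ᴷ Kneg x′
  ≈ᴷ-neg (a , b) = ≈-neg a , ≈-neg b

  ≈ᴷ-* : ∀ {x x′ y y′} → x ≈ᴷ x′ → y ≈ᴷ y′ → Kmul α x y ≈ᴷ Kmul α x′ y′
  ≈ᴷ-* (a , b) (c , d) = ≈-+ (≈-* a c) (≈-* (≈-refl {+ α}) (≈-* b d)) , ≈-+ (≈-* a d) (≈-* b c)

  record InZp (z : K) : Set where
    constructor inZp
    field p∣im : + p ∣ proj₂ z
  open InZp public

  InZp-+ : ∀ {x y} → InZp x → InZp y → InZp (Kadd x y)
  InZp-+ (inZp p∣x₂) (inZp p∣y₂) = inZp (∣m∣n⇒∣m+n p∣x₂ p∣y₂)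

  InZp-neg : ∀ {x} → InZp x → InZp (Kneg x)
  InZp-neg (inZp p∣x₂) = inZp (∣m⇒∣-m p∣x₂)

  InZp-- : ∀ {x y} → InZp x → InZp y → InZp (Kadd x (Kneg y))
  InZp-- x∈ y∈ = InZp-+ x∈ (InZp-neg y∈)

  difference-InZp : ∀ {x y} → x ≈ᴷ y → InZp (Kadd x (Kneg y))
  difference-InZp (_ , mod p∣d) = inZp p∣d

  InZp-* : ∀ {x y} → InZp x → InZp y → InZp (Kmul α x y)
  InZp-* {x₁ , _} {y₁ , _} (inZp p∣x₂) (inZp p∣y₂) =
    inZp (∣m∣n⇒∣m+n (∣n⇒∣m*n x₁ p∣y₂) (∣m⇒∣m*n y₁ p∣x₂))

module ModularGeometry (p α : ℕ) where
  open import Data.Integer.Divisibility.Signed using (_∣_; _∣?_)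
  open import Relation.Binary.Bundles using (Setoid)
  open import Relation.Nullary.Decidable using (decidable-stable)
  open QuadraticIntegers α using (ℤ[√α])
  open CommutativeRing ℤ[√α] using (_*_)
  open PlaneIdentities α
  open Congruences p α
  open Setoid ≈ᴷ-setoid using () renaming (refl to ≈ᴷ-refl; sym to ≈ᴷ-sym)

  side : ∀ {u v d} → IsDistance p α u v d → ι d * ι d ≈ᴷ quadrance u v
  side {u} {v} {d} (_ , d²) = subst (_≈ᴷ quadrance u v) (ι-* d d) (≈ᴷ-sym (fromKCongr d²))

  heronForm-cong : ∀ {A B C A′ B′ C′} → A ≈ᴷ A′ → B ≈ᴷ B′ → C ≈ᴷ C′ →
    heronForm A B C ≈ᴷ heronForm A′ B′ C′
  heronForm-cong A≈ B≈ C≈ = ≈ᴷ-+ (≈ᴷ-* (≈ᴷ-* (≈ᴷ-refl {two * two}) B≈) C≈) (≈ᴷ-neg (≈ᴷ-* D≈ D≈))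
    where D≈ = ≈ᴷ-+ (≈ᴷ-+ B≈ C≈) (≈ᴷ-neg A≈)

  heron-mod-p : ∀ {v₁ v₂ v₃ a b c} →
    IsDistance p α v₂ v₃ a → IsDistance p α v₁ v₃ b → IsDistance p α v₁ v₂ c →
    ι (V² a b c) ≈ᴷ Δ v₁ v₂ v₃ * Δ v₁ v₂ v₃
  heron-mod-p {v₁} {v₂} {v₃} {a} {b} {c} ∣v₂v₃∣ ∣v₁v₃∣ ∣v₁v₂∣ = begin
    ι (V² a b c)                                     ≡⟨ ι-heronProduct a b c ⟩
    heronProduct (ι a) (ι b) (ι c)                   ≡⟨ heronProduct-squares (ι a) (ι b) (ι c) ⟩
    heronForm (ι a * ι a) (ι b * ι b) (ι c * ι c)    ≈⟨ heronForm-cong sideA sideB sideC ⟩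
    heronForm (quadrance v₂ v₃) (quadrance v₁ v₃) (quadrance v₁ v₂)
                                                     ≡⟨ heron v₁ v₂ v₃ ⟩
    Δ v₁ v₂ v₃ * Δ v₁ v₂ v₃                          ∎
    where
    open import Relation.Binary.Reasoning.Setoid ≈ᴷ-setoid
    sideA = side {v₂} {v₃} {a} ∣v₂v₃∣
    sideB = side {v₁} {v₃} {b} ∣v₁v₃∣
    sideC = side {v₁} {v₂} {c} ∣v₁v₂∣

  coincident⇒InZp : ∀ {u v} → PointEq p u v → InZp (quadrance u v)
  coincident⇒InZp {u₁ , u₂} {v₁ , v₂} (u₁≡v₁ , u₂≡v₂) = InZp-+ (InZp-* d₁ d₁) (InZp-* d₂ d₂)
    where
    d₁ : InZp (u₁ - v₁)
    d₁ = difference-InZp {u₁} {v₁} (fromKCongr u₁≡v₁)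
    d₂ : InZp (u₂ - v₂)
    d₂ = difference-InZp {u₂} {v₂} (fromKCongr u₂≡v₂)

  distance⇒InZp : ∀ {u v d} → IsDistance p α u v d → InZp (quadrance u v)
  distance⇒InZp (_ , (_ , im≈0)) = inZp (≈0⇒∣ (fromCongr im≈0))

  module _ {𝒫 : Point → Set} (integral : IntegralPointSet p α 𝒫) where

    -- in an integral point set every quadrance lies in ℤ_p: two points coincide or span a side
    -- (the case split is justified by decidability of p ∣ _)
    quadrance-InZp : ∀ {u v} → 𝒫 u → 𝒫 v → InZp (quadrance u v)
    quadrance-InZp {u} {v} 𝒫u 𝒫v = inZp (decidable-stable (+ p ∣? _) ¬¬p∣)
      where
      ¬¬p∣ : ¬ ¬ (+ p ∣ proj₂ (quadrance u v))
      ¬¬p∣ p∤ with integral u v 𝒫u 𝒫v (p∤ ∘ p∣im ∘ coincident⇒InZp {u} {v})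
      ... | d , uv-distance = p∤ (p∣im (distance⇒InZp {u} {v} {d} uv-distance))

    polar-InZp : ∀ {u v w z} → 𝒫 u → 𝒫 v → 𝒫 w → 𝒫 z → InZp (polar u v w z)
    polar-InZp 𝒫u 𝒫v 𝒫w 𝒫z =
      InZp-- (InZp-- (InZp-+ (quadrance-InZp 𝒫u 𝒫z) (quadrance-InZp 𝒫v 𝒫w))
                     (quadrance-InZp 𝒫u 𝒫w))
             (quadrance-InZp 𝒫v 𝒫z)

    ΔΔ-InZp : ∀ {v₁ v₂ v₃ w₁ w₂ w₃} → 𝒫 v₁ → 𝒫 v₂ → 𝒫 v₃ → 𝒫 w₁ → 𝒫 w₂ → 𝒫 w₃ →
      InZp (Δ v₁ v₂ v₃ * Δ w₁ w₂ w₃)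
    ΔΔ-InZp {v₁} {v₂} {v₃} {w₁} {w₂} {w₃} 𝒫v₁ 𝒫v₂ 𝒫v₃ 𝒫w₁ 𝒫w₂ 𝒫w₃ =
      subst InZp (binetCauchy v₁ v₂ v₃ w₁ w₂ w₃)
        (InZp-- (InZp-* (polar-InZp 𝒫v₂ 𝒫v₁ 𝒫w₂ 𝒫w₁) (polar-InZp 𝒫v₃ 𝒫v₁ 𝒫w₃ 𝒫w₁))
                (InZp-* (polar-InZp 𝒫v₂ 𝒫v₁ 𝒫w₃ 𝒫w₁) (polar-InZp 𝒫v₃ 𝒫v₁ 𝒫w₂ 𝒫w₁)))

module ResidueCharacter (p α : ℕ) (p-prime : Prime p) (odd : p % 2 ≡ 1) (α-qnr : QNR p (+ α)) where
  open import Data.Integer using (_+_; _-_; _*_; -_; -[1+_]) renaming (∣_∣ to abs)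
  import Data.Integer.Properties as ℤ
  open import Data.Integer.Tactic.RingSolver using (solve-∀)
  open import Data.Integer.Divisibility.Signed using (_∣_; divides; ∣ᵤ⇒∣; ∣⇒∣ᵤ)
  import Data.Nat as ℕ
  import Data.Nat.Divisibility as ℕ
  open import Data.Nat.Primality using (euclidsLemma; prime⇒irreducible; irreducible[2]; ¬prime[1])
  open import Data.Nat.Coprimality using (Coprime; coprime-Bézout)
  open import Data.Nat.GCD using (module Bézout)
  open import Data.Sum using (_⊎_; inj₁; inj₂; fromInj₂)
  open import Data.Empty using (⊥-elim)
  open import Function.Construct.Composition using (_⇔-∘_)
  open import Function.Construct.Symmetry using (⇔-sym)
  open QuadraticIntegers α using (ℤ[√α])
  open CommutativeRing ℤ[√α] using () renaming (*-comm to *ᴷ-comm)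
  open Congruences p α

  euclid : ∀ x y → + p ∣ x * y → + p ∣ x ⊎ + p ∣ y
  euclid x y p∣xy with euclidsLemma (abs x) (abs y) p-prime (subst (p ℕ.∣_) (ℤ.abs-* x y) (∣⇒∣ᵤ p∣xy))
  ... | inj₁ p∣x = inj₁ (∣ᵤ⇒∣ p∣x)
  ... | inj₂ p∣y = inj₂ (∣ᵤ⇒∣ p∣y)

  p∤2 : ¬ + p ∣ + 2
  p∤2 p∣2 with irreducible[2] (∣⇒∣ᵤ p∣2)
  ... | inj₁ p≡1 = ¬prime[1] (subst Prime p≡1 p-prime)
  ... | inj₂ p≡2 with () ← trans (sym odd) (cong (_% 2) p≡2)

  cancel-2 : ∀ x → + p ∣ + 2 * x → + p ∣ x
  cancel-2 x p∣2x with euclid (+ 2) x p∣2x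
  ... | inj₁ p∣2 = ⊥-elim (p∤2 p∣2)
  ... | inj₂ p∣x = p∣x

  ±-inverse : ∀ {n} → Coprime p n → ∃ λ t → + p ∣ t * + n + + 1 ⊎ + p ∣ t * + n - + 1
  ±-inverse {n} p⊥n with coprime-Bézout p⊥n
  ... | Bézout.+- a b 1+bn≡ap = + b , inj₁ (divides (+ a) (begin
    + b * + n + + 1     ≡⟨ cong (_+ + 1) (ℤ.pos-* b n) ⟨
    + (b ℕ.* n) + + 1   ≡⟨ ℤ.+-comm (+ (b ℕ.* n)) (+ 1) ⟩
    + (1 ℕ.+ b ℕ.* n)   ≡⟨ cong +_ 1+bn≡ap ⟩
    + (a ℕ.* p)         ≡⟨ ℤ.pos-* a p ⟩
    + a * + p           ∎))
    where open ≡-Reasoning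
  ... | Bézout.-+ a b 1+ap≡bn = + b , inj₂ (divides (+ a) (begin
    + b * + n - + 1             ≡⟨ cong (_- + 1) (ℤ.pos-* b n) ⟨
    + (b ℕ.* n) - + 1           ≡⟨ cong (λ m → + m - + 1) 1+ap≡bn ⟨
    + 1 + + (a ℕ.* p) - + 1     ≡⟨ cancel (+ (a ℕ.* p)) ⟩
    + (a ℕ.* p)                 ≡⟨ ℤ.pos-* a p ⟩
    + a * + p                   ∎))
    where open ≡-Reasoning
          cancel : ∀ m → + 1 + m - + 1 ≡ m
          cancel = solve-∀

  abs-square : ∀ x → + abs x * + abs x ≡ x * x
  abs-square (+ n)    = refl
  abs-square -[1+ n ] = refl

  -- if p ∤ x then x² is invertible mod p: t²x² ≡ 1, as (t|x|)² − 1 = (t|x| − 1)(t|x| + 1)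
  square-invertible : ∀ x → ¬ + p ∣ x → ∃ λ t → + p ∣ t * t * (x * x) - + 1
  square-invertible x p∤x with ±-inverse p⊥x
    where
    p⊥x : Coprime p (abs x)
    p⊥x {d} (d∣p , d∣x) with prime⇒irreducible p-prime d∣p
    ... | inj₁ d≡1 = d≡1
    ... | inj₂ refl = ⊥-elim (p∤x (∣ᵤ⇒∣ d∣x))
  ... | t , ±1 = t , subst (λ x² → + p ∣ t * t * x² - + 1) (abs-square x) (difference-of-squares ±1)
    where
    difference-of-squares : ∀ {m} → + p ∣ t * m + + 1 ⊎ + p ∣ t * m - + 1 → + p ∣ t * t * (m * m) - + 1
    difference-of-squares {m} (inj₁ p∣tm+1) = ∣-lin₁ (t * m - + 1) p∣tm+1 (factor t m)
      where factor : ∀ t m → t * t * (m * m) - + 1 ≡ (t * m - + 1) * (t * m + + 1)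
            factor = solve-∀
    difference-of-squares {m} (inj₂ p∣tm-1) = ∣-lin₁ (t * m + + 1) p∣tm-1 (factor t m)
      where factor : ∀ t m → t * t * (m * m) - + 1 ≡ (t * m + + 1) * (t * m - + 1)
            factor = solve-∀

  -- If z² ∈ ℤ_p, i.e. p ∣ 2rs, then z is "real" (p ∣ s) or "imaginary" (p ∣ r).
  square-InZp : ∀ r s → InZp (Kmul α (r , s) (r , s)) → + p ∣ r ⊎ + p ∣ s
  square-InZp r s (inZp p∣rs+sr) = euclid r s (cancel-2 (r * s) (subst (+ p ∣_) (double r s) p∣rs+sr))
    where double : ∀ r s → r * s + s * r ≡ + 2 * (r * s)
          double = solve-∀

  module _ {r s V : ℤ} (V≈ : V ≈ r * r + + α * (s * s)) (V≉0 : ¬ V ≈ + 0) where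

    nonzero : + p ∣ r → ¬ + p ∣ s
    nonzero p∣r p∣s = V≉0 (≈-trans V≈ (∣⇒≈0 (∣-lin₂ r (+ α * s) p∣r p∣s (eq r s (+ α)))))
      where eq : ∀ r s A → r * r + A * (s * s) ≡ r * r + A * s * s
            eq = solve-∀

    real⇒QR : + p ∣ s → QR p V
    real⇒QR p∣s = V≉0 ∘ fromCongr , r , toCongr {r * r} {V}
      (mod (∣-lin₂ (- + 1) (- (+ α * s)) (p∣a-b V≈) p∣s (eq r s V (+ α))))
      where eq : ∀ r s V A → r * r - V ≡ (- + 1) * (V - (r * r + A * (s * s))) + (- (A * s)) * s
            eq = solve-∀

    -- for imaginary z, V ≡ αs² is a non-residue since α is and s is a unit
    imaginary⇒¬QR : + p ∣ r → ¬ QR p V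
    imaginary⇒¬QR p∣r (_ , y , y²≡V) = proj₂ α-qnr (y * t , toCongr {y * t * (y * t)} {+ α} (mod
        (∣-lin₃ (t * t) (t * t * r) (+ α) (p∣a-b (≈-trans (fromCongr {y * y} {V} y²≡V) V≈)) p∣r p∣t²s²-1
                (eq y t r s (+ α)))))
      where
      inverse = square-invertible s (nonzero p∣r)
      t = proj₁ inverse
      p∣t²s²-1 = proj₂ inverse
      eq : ∀ y t r s A → y * t * (y * t) - A
             ≡ t * t * (y * y - (r * r + A * (s * s))) + t * t * r * r + A * (t * t * (s * s) - + 1)
      eq = solve-∀

    character : InZp (Kmul α (r , s) (r , s)) → QR p V ⇔ + p ∣ s
    character z²∈ = mk⇔ residue⇒real real⇒QR
      where
      residue⇒real : QR p V → + p ∣ s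
      residue⇒real qr = fromInj₂ (λ p∣r → ⊥-elim (imaginary⇒¬QR p∣r qr)) (square-InZp r s z²∈)

    transfer : ∀ {r′ s′} → InZp (Kmul α (r , s) (r′ , s′)) → + p ∣ s → + p ∣ s′
    transfer {r′} {s′} (inZp p∣rs′+sr′) p∣s =
      fromInj₂ (λ p∣r → ⊥-elim (nonzero p∣r p∣s))
               (euclid r s′ (∣-lin₂ (+ 1) (- r′) p∣rs′+sr′ p∣s (eq r s r′ s′)))
      where eq : ∀ r s r′ s′ → r * s′ ≡ + 1 * (r * s′ + s * r′) + (- r′) * s
            eq = solve-∀

  sameCharacter : ∀ {V V′} z z′ → V ≈ proj₁ (Kmul α z z) → V′ ≈ proj₁ (Kmul α z′ z′) →
    ¬ V ≈ + 0 → ¬ V′ ≈ + 0 → InZp (Kmul α z z) → InZp (Kmul α z′ z′) → InZp (Kmul α z z′) →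
    QR p V ⇔ QR p V′
  sameCharacter (r , s) (r′ , s′) V≈ V′≈ V≉0 V′≉0 z²∈ z′²∈ zz′∈ =
    ⇔-sym (character {r′} {s′} V′≈ V′≉0 z′²∈) ⇔-∘ (real-together ⇔-∘ character {r} {s} V≈ V≉0 z²∈)
    where
    real-together : + p ∣ s ⇔ + p ∣ s′
    real-together = mk⇔ (transfer {r} {s} V≈ V≉0 zz′∈)
                        (transfer {r′} {s′} V′≈ V′≉0 (subst InZp (*ᴷ-comm (r , s) (r′ , s′)) zz′∈))

theorem7 : (p α : ℕ) → Prime p → p % 2 ≡ 1 → IsSmallestNonResidue p α →
    (𝒫 : Point → Set) → IntegralPointSet p α 𝒫 →
    (v₁ v₂ v₃ w₁ w₂ w₃ : Point) → 𝒫 v₁ → 𝒫 v₂ → 𝒫 v₃ → 𝒫 w₁ → 𝒫 w₂ → 𝒫 w₃ →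
    (a b c a′ b′ c′ : ℤ) →
    IsDistance p α v₂ v₃ a → IsDistance p α v₁ v₃ b → IsDistance p α v₁ v₂ c →
    IsDistance p α w₂ w₃ a′ → IsDistance p α w₁ w₃ b′ → IsDistance p α w₁ w₂ c′ →
    ¬ Congr p (V² a b c) (+ 0) → ¬ Congr p (V² a′ b′ c′) (+ 0) →
    QR p (V² a b c) ⇔ QR p (V² a′ b′ c′)
theorem7 p α p-prime odd (_ , α-qnr , _) 𝒫 integral v₁ v₂ v₃ w₁ w₂ w₃ 𝒫v₁ 𝒫v₂ 𝒫v₃ 𝒫w₁ 𝒫w₂ 𝒫w₃
         a b c a′ b′ c′ ∣v₂v₃∣ ∣v₁v₃∣ ∣v₁v₂∣ ∣w₂w₃∣ ∣w₁w₃∣ ∣w₁w₂∣ V≉0 V′≉0 =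
  sameCharacter (Δ v₁ v₂ v₃) (Δ w₁ w₂ w₃)
    (proj₁ (heron-mod-p {v₁} {v₂} {v₃} {a} {b} {c} ∣v₂v₃∣ ∣v₁v₃∣ ∣v₁v₂∣))
    (proj₁ (heron-mod-p {w₁} {w₂} {w₃} {a′} {b′} {c′} ∣w₂w₃∣ ∣w₁w₃∣ ∣w₁w₂∣))
    (V≉0 ∘ toCongr) (V′≉0 ∘ toCongr)
    (ΔΔ-InZp integral 𝒫v₁ 𝒫v₂ 𝒫v₃ 𝒫v₁ 𝒫v₂ 𝒫v₃)
    (ΔΔ-InZp integral 𝒫w₁ 𝒫w₂ 𝒫w₃ 𝒫w₁ 𝒫w₂ 𝒫w₃)
    (ΔΔ-InZp integral 𝒫v₁ 𝒫v₂ 𝒫v₃ 𝒫w₁ 𝒫w₂ 𝒫w₃)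
  where
  open PlaneIdentities α using (Δ)
  open Congruences p α using (toCongr)
  open ModularGeometry p α using (heron-mod-p; ΔΔ-InZp)
  open ResidueCharacter p α p-prime odd α-qnr using (sameCharacter)
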